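{- The following super-strong Wilf equivalences hold: (i$_1$) $(\underline{\geq,<})\stackrel{ss}{\sim}(\underline{<,\geq})$; (ii) $(\underline{\geq,\geq})\stackrel{ss}{\sim}(\underline{<,<})$.
   Context: An inversion sequence of length $n$ is an integer sequence $e=e_1\dots e_n$ with $0\le e_i<i$ for all $i$; $\mathbf{I}_n$ is the set of these. For relations $R_1,R_2\in\{\leq,\geq,<,>,=,\neq\}$, an occurrence of the consecutive pattern of relations $(\underline{R_1,R_2})$ in position $i$ of $e$ means $e_iR_1e_{i+1}$ and $e_{i+1}R_2e_{i+2}$. Two patterns $p,p'$ are super-strongly Wilf equivalent ($p\stackrel{ss}{\sim}p'$) if for all $n$ and all $S\subseteq[n]$, the number of $e\in\mathbf{I}_n$ whose set of positions of occurrences of $p$ is exactly $S$ equals the corresponding number for $p'$. -}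

module Defs where

open import Data.Nat using (ℕ; zero; suc; _+_; _≤_; _<_; _≥_; _≟_; _<?_; _≤?_)
open import Data.Fin using (Fin; toℕ)
open import Data.Fin.Subset using (Subset; inside; outside)
open import Data.Vec using (Vec; tabulate; lookup)
open import Data.Bool using (Bool; true; false; _∧_)
open import Data.Product using (Σ)
open import Relation.Nullary using (¬_; Dec; yes; no)
open import Relation.Nullary.Decidable using (⌊_⌋)
open import Relation.Binary.PropositionalEquality using (_≡_)

-- Inversion sequences of length n, stored as a list built from the right:
-- snoc e x appends a new last entry; the k-th entry (1-indexed) is an element
-- of Fin k, i.e. a natural number e_k with 0 ≤ e_k < k.
-- (An inductive representation, so that equality is decidable/first-order.)
data InvSeq : ℕ → Set where
  []   : InvSeq zero
  snoc : ∀ {n} → InvSeq n → Fin (suc n) → InvSeq (suc n)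

val : ∀ {n} → InvSeq n → Fin n → ℕ
val {suc n} (snoc e x) j with toℕ j <? n
... | yes j<n = val e (Data.Fin.fromℕ< j<n)
... | no _    = toℕ x

data Rel : Set where
  ≤r ≥r <r >r =r ≠r : Rel

holds : Rel → ℕ → ℕ → Bool
holds ≤r a b = ⌊ a ≤? b ⌋
holds ≥r a b = ⌊ b ≤? a ⌋
holds <r a b = ⌊ a <? b ⌋
holds >r a b = ⌊ b <? a ⌋
holds =r a b = ⌊ a ≟ b ⌋
holds ≠r a b with a ≟ b
... | yes _ = false
... | no _  = true

record Pattern : Set where
  constructor pat
  field
    R₁ R₂ : Rel

-- value of e at the natural-number position k (0 if out of range; only used in range)
valℕ : ∀ {n} → InvSeq n → ℕ → ℕ
valℕ {n} e k with k <? n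
... | yes k<n = val e (Data.Fin.fromℕ< k<n)
... | no _ = 0

occursAt : ∀ {n} → Pattern → InvSeq n → Fin n → Bool
occursAt {n} (pat R₁ R₂) e j with suc (suc (toℕ j)) <? n
... | no _ = false
... | yes _ = holds R₁ (valℕ e (toℕ j)) (valℕ e (suc (toℕ j)))
            ∧ holds R₂ (valℕ e (suc (toℕ j))) (valℕ e (suc (suc (toℕ j))))

Occ : ∀ {n} → Pattern → InvSeq n → Subset n
Occ p e = tabulate (occursAt p e)

InvWithOcc : (p : Pattern) (n : ℕ) (S : Subset n) → Set
InvWithOcc p n S = Σ (InvSeq n) (λ e → Occ p e ≡ S)

module Submission where

-- The complement e ↦ e′ with e′ᵢ = (i − 1) − eᵢ is an involution on inversion sequences.
-- Since eᵢ ≤ i − 1 and eᵢ₊₁ ≤ i, we have e′ᵢ ≥ e′ᵢ₊₁ iff eᵢ < eᵢ₊₁, and e′ᵢ < e′ᵢ₊₁ iff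
-- eᵢ ≥ eᵢ₊₁. So the complement maps the occurrence set of (≥,<) in e onto that of (<,≥)
-- in e′, and that of (≥,≥) onto that of (<,<), which gives both bijections.

open import Defs
open import Data.Nat using (ℕ; suc; _∸_; _≤_; _<_; z≤n; _<?_; _≤?_)
open import Data.Nat.Properties
  using (≤-pred; ≤-antisym; ≤-trans; ≤-reflexive; <-trans; n<1+n; ≮⇒≥; ≰⇒>; <⇒≱; ∸-monoʳ-≤; +-∸-assoc)
open import Data.Fin using (Fin; toℕ; fromℕ<; opposite)
open import Data.Fin.Properties using (opposite-prop; opposite-involutive; toℕ-fromℕ<; toℕ<n; toℕ≤pred[n])
open import Data.Fin.Subset using (Subset)
open import Data.Vec.Properties using (tabulate-cong)
open import Data.Bool using (_∧_)
open import Data.Empty using (⊥-elim)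
open import Data.Product using (_×_; _,_)
open import Data.Product.Function.Dependent.Propositional using (Σ-↔)
open import Function.Bundles using (_⇔_; mk⇔; _↔_; mk↔ₛ′)
open import Function.Properties.Inverse using (↔-refl)
open import Relation.Nullary using (¬_; yes; no)
open import Relation.Nullary.Decidable using (Dec; ⌊_⌋; does-⇔; isYes≗does)
open import Relation.Binary.PropositionalEquality

complement : ∀ {n} → InvSeq n → InvSeq n
complement []         = []
complement (snoc e x) = snoc (complement e) (opposite x)

complement-involutive : ∀ {n} (e : InvSeq n) → complement (complement e) ≡ e
complement-involutive []         = refl
complement-involutive (snoc e x) = cong₂ snoc (complement-involutive e) (opposite-involutive x)

complement-↔ : ∀ {n} → InvSeq n ↔ InvSeq n
complement-↔ = mk↔ₛ′ complement complement complement-involutive complement-involutive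

toℕ≡last : ∀ {n} (j : Fin (suc n)) → ¬ toℕ j < n → toℕ j ≡ n
toℕ≡last j j≮n = ≤-antisym (≤-pred (toℕ<n j)) (≮⇒≥ j≮n)

val-complement : ∀ {n} (e : InvSeq n) (j : Fin n) → val (complement e) j ≡ toℕ j ∸ val e j
val-complement {suc n} (snoc e x) j with toℕ j <? n
... | yes j<n = trans (val-complement e (fromℕ< j<n)) (cong (_∸ val e (fromℕ< j<n)) (toℕ-fromℕ< j<n))
... | no  j≮n = trans (opposite-prop x) (cong (_∸ toℕ x) (sym (toℕ≡last j j≮n)))

val≤toℕ : ∀ {n} (e : InvSeq n) (j : Fin n) → val e j ≤ toℕ j
val≤toℕ {suc n} (snoc e x) j with toℕ j <? n
... | yes j<n = ≤-trans (val≤toℕ e (fromℕ< j<n)) (≤-reflexive (toℕ-fromℕ< j<n))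
... | no  j≮n = ≤-trans (toℕ≤pred[n] x) (≤-reflexive (sym (toℕ≡last j j≮n)))

valℕ-complement : ∀ {n} (e : InvSeq n) k → k < n → valℕ (complement e) k ≡ k ∸ valℕ e k
valℕ-complement {n} e k k<n with k <? n
... | yes k<n′ = trans (val-complement e (fromℕ< k<n′)) (cong (_∸ val e (fromℕ< k<n′)) (toℕ-fromℕ< k<n′))
... | no  k≮n  = ⊥-elim (k≮n k<n)

valℕ≤index : ∀ {n} (e : InvSeq n) k → valℕ e k ≤ k
valℕ≤index {n} e k with k <? n
... | yes k<n = ≤-trans (val≤toℕ e (fromℕ< k<n)) (≤-reflexive (toℕ-fromℕ< k<n))
... | no  _   = z≤n

<⇒complement-≥ : ∀ {k a b} → a < b → suc k ∸ b ≤ k ∸ a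
<⇒complement-≥ {k} = ∸-monoʳ-≤ (suc k)

≥⇒complement-< : ∀ {k a b} → a ≤ k → b ≤ a → k ∸ a < suc k ∸ b
≥⇒complement-< {k} a≤k b≤a =
  ≤-trans (≤-reflexive (sym (+-∸-assoc 1 a≤k))) (∸-monoʳ-≤ (suc k) b≤a)

complement-≥⇔< : ∀ {k a b} → a ≤ k → (suc k ∸ b ≤ k ∸ a) ⇔ (a < b)
complement-≥⇔< a≤k = mk⇔
  (λ ≥′ → ≰⇒> (λ b≤a → <⇒≱ (≥⇒complement-< a≤k b≤a) ≥′))
  <⇒complement-≥

complement-<⇔≥ : ∀ {k a b} → a ≤ k → (k ∸ a < suc k ∸ b) ⇔ (b ≤ a)
complement-<⇔≥ a≤k = mk⇔
  (λ <′ → ≮⇒≥ (λ a<b → <⇒≱ <′ (<⇒complement-≥ a<b)))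
  (≥⇒complement-< a≤k)

isYes-⇔ : ∀ {A B : Set} → A ⇔ B → (a? : Dec A) (b? : Dec B) → ⌊ a? ⌋ ≡ ⌊ b? ⌋
isYes-⇔ A⇔B a? b? = trans (isYes≗does a?) (trans (does-⇔ A⇔B a? b?) (sym (isYes≗does b?)))

-- a and b are the entries at positions k and k + 1 (counted from 0), so k ∸ a and (k + 1) ∸ b
-- are their complements; of the two bounds a ≤ k and b ≤ k + 1 only the first is needed.
ComplementDual : Rel → Rel → Set
ComplementDual R R′ = ∀ k a b → a ≤ k → holds R (k ∸ a) (suc k ∸ b) ≡ holds R′ a b

≥-dual-< : ComplementDual ≥r <r
≥-dual-< k a b a≤k = isYes-⇔ (complement-≥⇔< a≤k) (suc k ∸ b ≤? k ∸ a) (a <? b)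

<-dual-≥ : ComplementDual <r ≥r
<-dual-≥ k a b a≤k = isYes-⇔ (complement-<⇔≥ a≤k) (k ∸ a <? suc k ∸ b) (b ≤? a)

occursAt-complement : ∀ {R₁ R₂ R₁′ R₂′} → ComplementDual R₁ R₁′ → ComplementDual R₂ R₂′ →
                      ∀ {n} (e : InvSeq n) (j : Fin n) →
                      occursAt (pat R₁ R₂) (complement e) j ≡ occursAt (pat R₁′ R₂′) e j
occursAt-complement {R₁} {R₂} dual₁ dual₂ {n} e j with suc (suc (toℕ j)) <? n
... | no  _    = refl
... | yes k+2<n = cong₂ _∧_
  (trans (cong₂ (holds R₁) (valℕ-complement e k k<n) (valℕ-complement e (suc k) k+1<n))
         (dual₁ k _ _ (valℕ≤index e k)))
  (trans (cong₂ (holds R₂) (valℕ-complement e (suc k) k+1<n) (valℕ-complement e (suc (suc k)) k+2<n))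
         (dual₂ (suc k) _ _ (valℕ≤index e (suc k))))
  where
  k = toℕ j
  k+1<n = <-trans (n<1+n (suc k)) k+2<n
  k<n   = <-trans (n<1+n k) k+1<n

Occ-complement : ∀ {R₁ R₂ R₁′ R₂′} → ComplementDual R₁ R₁′ → ComplementDual R₂ R₂′ →
                 ∀ {n} (e : InvSeq n) → Occ (pat R₁ R₂) (complement e) ≡ Occ (pat R₁′ R₂′) e
Occ-complement dual₁ dual₂ e = tabulate-cong (occursAt-complement dual₁ dual₂ e)

InvWithOcc-↔ : ∀ {p q} → (∀ {n} (e : InvSeq n) → Occ q (complement e) ≡ Occ p e) →
               (n : ℕ) (S : Subset n) → InvWithOcc p n S ↔ InvWithOcc q n S
InvWithOcc-↔ {p} occ n S = Σ-↔ complement-↔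
  (λ {e} → subst (λ T → (Occ p e ≡ S) ↔ (T ≡ S)) (sym (occ e)) ↔-refl)

proposition3p5 :
    ((n : ℕ) (S : Subset n) → InvWithOcc (pat ≥r <r) n S ↔ InvWithOcc (pat <r ≥r) n S)
    × ((n : ℕ) (S : Subset n) → InvWithOcc (pat ≥r ≥r) n S ↔ InvWithOcc (pat <r <r) n S)
proposition3p5 = InvWithOcc-↔ (Occ-complement <-dual-≥ ≥-dual-<)
               , InvWithOcc-↔ (Occ-complement <-dual-≥ <-dual-≥)
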